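{- For every positive integer $n$, the number of partitions $\pi$ with $\Gamma(\pi)=n$ whose parts pairwise differ by at least $2$ equals the number of partitions $\pi=(\pi_1,\ldots,\pi_r)$ with $\Gamma(\pi)=n$ such that every part is $\equiv 1$ or $4\pmod 5$ and $\pi_i-\pi_{i+1}\le 5$ for all $i=1,\ldots,r$ (with $\pi_{r+1}:=0$), with strict inequality whenever $\pi_i\equiv1\pmod 5$.
   Context: For a non-empty partition $\pi=(\pi_1\ge\cdots\ge\pi_r\ge1)$, $\ell(\pi)=r$ and $\Gamma(\pi)=\pi_1+\ell(\pi)-1$ (length of the largest hook, called perimeter). -}

module Defs where

open import Data.Nat using (ℕ; zero; suc; _+_; _∸_; _%_; _≤ᵇ_; _≡ᵇ_)
open import Data.Bool using (Bool; true; false; _∧_; _∨_; not; T)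
open import Data.List using (List; []; _∷_; length)

weaklyDecPos : List ℕ → Bool
weaklyDecPos [] = true
weaklyDecPos (a ∷ []) = 1 ≤ᵇ a
weaklyDecPos (a ∷ b ∷ rest) = (b ≤ᵇ a) ∧ weaklyDecPos (b ∷ rest)

isPartition : List ℕ → Bool
isPartition [] = false
isPartition (a ∷ rest) = weaklyDecPos (a ∷ rest)

largestPart : List ℕ → ℕ
largestPart [] = 0
largestPart (a ∷ _) = a

Γ : List ℕ → ℕ
Γ π = largestPart π + length π ∸ 1

-- parts pairwise differ by at least 2 (for a weakly decreasing list it
-- suffices to check consecutive parts: π_i − π_{i+1} ≥ 2)
diff2 : List ℕ → Bool
diff2 [] = true
diff2 (a ∷ []) = true
diff2 (a ∷ b ∷ rest) = ((b + 2) ≤ᵇ a) ∧ diff2 (b ∷ rest)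

partOK : ℕ → Bool
partOK a = ((a % 5) ≡ᵇ 1) ∨ ((a % 5) ≡ᵇ 4)

gapOK : ℕ → ℕ → Bool
gapOK a b = (a ≤ᵇ (b + 5)) ∧ (not ((a % 5) ≡ᵇ 1) ∨ (a ≤ᵇ (b + 4)))

mod5cond : List ℕ → Bool
mod5cond [] = true
mod5cond (a ∷ []) = partOK a ∧ gapOK a 0
mod5cond (a ∷ b ∷ rest) = partOK a ∧ gapOK a b ∧ mod5cond (b ∷ rest)

-- the two sets of partitions with perimeter n (as Σ-types; the predicates
-- are of the form T b, hence proof-irrelevant)
Diff2Parts : ℕ → Set
Diff2Parts n = Σ' where
  open import Data.Product using (Σ; _×_)
  open import Relation.Binary.PropositionalEquality using (_≡_)
  Σ' : Set
  Σ' = Σ (List ℕ) λ π → T (isPartition π ∧ diff2 π) × Γ π ≡ n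

Mod5Parts : ℕ → Set
Mod5Parts n = Σ' where
  open import Data.Product using (Σ; _×_)
  open import Relation.Binary.PropositionalEquality using (_≡_)
  Σ' : Set
  Σ' = Σ (List ℕ) λ π → T (isPartition π ∧ mod5cond π) × Γ π ≡ n

-- Both families satisfy c(n + 2) = c(n + 1) + c(n − 1), with c(−1) = 0, and each has
-- no member of perimeter 0 and exactly one, (1), of perimeter 1.  For difference-2
-- partitions the recurrence comes from the largest part: delete it if it exceeds
-- the next part by exactly 2 (the perimeter drops by 3), otherwise lower it by 1.
-- In the mod-5 family the two largest parts (a, b) are either equal, and deleting a
-- copy drops the perimeter by 1, or they are (b + 3, b) with b ≡ 1, or (b + 2, b) or
-- (b + 5, b) with b ≡ 4 (mod 5); lowering a by 3 in the first and last case and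
-- deleting it in the middle one drops the perimeter by 3.  The singleton (4) is
-- lowered to (1).
module Submission where

open import Defs
open import Data.Nat
open import Data.Nat.Properties
open import Data.Nat.DivMod using (%-distribˡ-+)
open import Data.Bool using (Bool; true; false; _∧_; _∨_; not; T)
open import Data.Bool.Properties using (T-∧; T-∨; T-irrelevant)
open import Data.List using (List; []; _∷_; length)
open import Data.Product using (Σ; _×_; _,_; proj₁; proj₂)
open import Data.Sum using (_⊎_; inj₁; inj₂)
open import Data.Unit using (⊤; tt)
open import Data.Empty using (⊥; ⊥-elim)
open import Relation.Nullary using (¬_; yes; no)
open import Relation.Binary.PropositionalEquality
open import Function.Base using (_∘_)
open import Function.Bundles using (_↔_; _⇔_; mk↔ₛ′; mk⇔; Equivalence)
open import Function.Properties.Inverse using (↔-refl; ↔-sym; ↔-trans)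
open import Data.Sum.Function.Propositional using (_⊎-↔_)

open Equivalence using (to; from)

Prev : (ℕ → Set) → ℕ → Set
Prev A zero    = ⊥
Prev A (suc n) = A n

↔-by-recurrence : {A B : ℕ → Set} → A 0 ↔ B 0 → A 1 ↔ B 1 →
                  (∀ k → A (2 + k) ↔ (A (1 + k) ⊎ Prev A k)) →
                  (∀ k → B (2 + k) ↔ (B (1 + k) ⊎ Prev B k)) →
                  ∀ n → A n ↔ B n
↔-by-recurrence {A} {B} A0↔B0 A1↔B1 recA recB = go
  where
  go   : ∀ n → A n ↔ B n
  prev : ∀ n → Prev A n ↔ Prev B n
  go zero          = A0↔B0
  go (suc zero)    = A1↔B1
  go (suc (suc k)) = ↔-trans (recA k) (↔-trans (go (suc k) ⊎-↔ prev k) (↔-sym (recB k)))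
  prev zero    = ↔-refl
  prev (suc n) = go n

¬↔⊥ : {A : Set} → ¬ A → A ↔ ⊥
¬↔⊥ ¬a = mk↔ₛ′ ¬a (λ ()) (λ ()) (λ a → ⊥-elim (¬a a))

IsPartitionWith : (List ℕ → Bool) → List ℕ → Set
IsPartitionWith Q π = T (isPartition π ∧ Q π)

Parts : (List ℕ → Bool) → ℕ → Set
Parts Q n = Σ (List ℕ) λ π → IsPartitionWith Q π × Γ π ≡ n

-- Parts⁺ Q k consists of the partitions of perimeter k − 1, indexed without subtraction.
Parts⁺ : (List ℕ → Bool) → ℕ → Set
Parts⁺ Q k = Σ (List ℕ) λ π → IsPartitionWith Q π × suc (Γ π) ≡ k

parts-≡ : ∀ {Q} {f : List ℕ → ℕ} {n} {x y : Σ (List ℕ) λ π → IsPartitionWith Q π × f π ≡ n} →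
          proj₁ x ≡ proj₁ y → x ≡ y
parts-≡ {x = π , p , e} {y = .π , q , e′} refl =
  cong₂ (λ p e → π , p , e) (T-irrelevant p q) (≡-irrelevant e e′)

Parts⁺↔Prev : ∀ Q k → Parts⁺ Q k ↔ Prev (Parts Q) k
Parts⁺↔Prev Q zero    = ¬↔⊥ λ ()
Parts⁺↔Prev Q (suc k) = mk↔ₛ′ (λ (π , p , e) → π , p , suc-injective e)
                              (λ (π , p , e) → π , p , cong suc e)
                              (λ _ → parts-≡ refl) (λ _ → parts-≡ refl)

Γ-∷ : ∀ a r → Γ (a ∷ r) ≡ a + length r
Γ-∷ a r = cong (_∸ 1) (+-suc a (length r))

Γ-+-head : ∀ c a r → Γ (c + a ∷ r) ≡ c + Γ (a ∷ r)
Γ-+-head c a r = begin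
  Γ (c + a ∷ r)      ≡⟨ Γ-∷ (c + a) r ⟩
  c + a + length r   ≡⟨ +-assoc c a (length r) ⟩
  c + (a + length r) ≡⟨ cong (c +_) (Γ-∷ a r) ⟨
  c + Γ (a ∷ r)      ∎
  where open ≡-Reasoning

Γ-prepend : ∀ c b r → Γ (c + b ∷ b ∷ r) ≡ c + suc (Γ (b ∷ r))
Γ-prepend c b r = begin
  Γ (c + b ∷ b ∷ r)          ≡⟨ Γ-∷ (c + b) (b ∷ r) ⟩
  c + b + suc (length r)     ≡⟨ +-assoc c b (suc (length r)) ⟩
  c + (b + suc (length r))   ≡⟨ cong (c +_) (+-suc b (length r)) ⟩
  c + suc (b + length r)     ≡⟨ cong (λ x → c + suc x) (Γ-∷ b r) ⟨
  c + suc (Γ (b ∷ r))        ∎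
  where open ≡-Reasoning

weaklyDecPos-head : ∀ a r → T (weaklyDecPos (a ∷ r)) → 1 ≤ a
weaklyDecPos-head a []      p = ≤ᵇ⇒≤ 1 a p
weaklyDecPos-head a (b ∷ r) p with to T-∧ p
... | b≤a , rest = ≤-trans (weaklyDecPos-head b r rest) (≤ᵇ⇒≤ b a b≤a)

partition-≤ : ∀ Q a b r → IsPartitionWith Q (a ∷ b ∷ r) → b ≤ a
partition-≤ Q a b r p = ≤ᵇ⇒≤ b a (proj₁ (to (T-∧ {b ≤ᵇ a}) (proj₁ (to (T-∧ {isPartition (a ∷ b ∷ r)}) p))))

perimeter-one : ∀ a r → 1 ≤ a → a + length r ≡ 1 → a ∷ r ≡ 1 ∷ []
perimeter-one (suc zero) [] _ _ = refl

Parts-0 : ∀ Q → Parts Q 0 ↔ ⊥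
Parts-0 Q = ¬↔⊥ λ where
  ([] , () , _)
  (a ∷ r , p , e) → 1+n≰n (≤-trans (weaklyDecPos-head a r (proj₁ (to T-∧ p)))
                                    (subst (a ≤_) (trans (sym (Γ-∷ a r)) e) (m≤m+n a (length r))))

Parts-1 : ∀ Q → T (Q (1 ∷ [])) → Parts Q 1 ↔ ⊤
Parts-1 Q q = mk↔ₛ′ (λ _ → tt) (λ _ → 1 ∷ [] , q , refl) (λ _ → refl) single
  where
  single : ∀ x → (1 ∷ [] , q , refl) ≡ x
  single ([] , () , _)
  single (a ∷ r , p , e) =
    parts-≡ (sym (perimeter-one a r (weaklyDecPos-head a r (proj₁ (to T-∧ p))) (trans (sym (Γ-∷ a r)) e)))

diff2-∷∷ : ∀ a b r → IsPartitionWith diff2 (a ∷ b ∷ r) ⇔ (2 + b ≤ a × IsPartitionWith diff2 (b ∷ r))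
diff2-∷∷ a b r = mk⇔ unfold fold
  where
  unfold : IsPartitionWith diff2 (a ∷ b ∷ r) → 2 + b ≤ a × IsPartitionWith diff2 (b ∷ r)
  unfold p with to (T-∧ {(b ≤ᵇ a) ∧ weaklyDecPos (b ∷ r)}) p
  ... | dec , d2 with to (T-∧ {b ≤ᵇ a}) dec | to (T-∧ {b + 2 ≤ᵇ a}) d2
  ... | _ , dec′ | gap , d2′ =
    subst (_≤ a) (+-comm b 2) (≤ᵇ⇒≤ (b + 2) a gap) , from (T-∧ {weaklyDecPos (b ∷ r)}) (dec′ , d2′)
  fold : 2 + b ≤ a × IsPartitionWith diff2 (b ∷ r) → IsPartitionWith diff2 (a ∷ b ∷ r)
  fold (gap , p) with to (T-∧ {weaklyDecPos (b ∷ r)}) p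
  ... | dec′ , d2′ = from (T-∧ {(b ≤ᵇ a) ∧ weaklyDecPos (b ∷ r)})
                       ( from (T-∧ {b ≤ᵇ a}) (≤⇒≤ᵇ (m+n≤o⇒n≤o 2 gap) , dec′)
                       , from (T-∧ {b + 2 ≤ᵇ a}) (≤⇒≤ᵇ (subst (_≤ a) (+-comm 2 b) gap) , d2′))

diff2-suc-head : ∀ a r → IsPartitionWith diff2 (a ∷ r) → IsPartitionWith diff2 (suc a ∷ r)
diff2-suc-head a []      _ = tt
diff2-suc-head a (b ∷ r) p with to (diff2-∷∷ a b r) p
... | gap , tail = from (diff2-∷∷ (suc a) b r) (m≤n⇒m≤1+n gap , tail)

diff2-split-top : ∀ k a b r → 2 + b ≤ suc a × IsPartitionWith diff2 (b ∷ r) → Γ (suc a ∷ b ∷ r) ≡ 2 + k →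
                  Parts diff2 (1 + k) ⊎ Parts⁺ diff2 k
diff2-split-top k a b r (gap , tail) e with a ≟ suc b
... | yes refl = inj₂ (b ∷ r , tail , +-cancelˡ-≡ 2 _ _ (trans (sym (Γ-prepend 2 b r)) e))
... | no a≢1+b =
  inj₁ (a ∷ b ∷ r , from (diff2-∷∷ a b r) (≤∧≢⇒< (≤-pred gap) (a≢1+b ∘ sym) , tail) ,
        suc-injective (trans (sym (Γ-+-head 1 a (b ∷ r))) e))

-- The singletons come last so that the tail is split before the largest part;
-- otherwise the clause for suc a ∷ b ∷ r would not reduce for a variable a.
diff2-split : ∀ k → Parts diff2 (2 + k) → Parts diff2 (1 + k) ⊎ Parts⁺ diff2 k
diff2-split k ([] , () , _)
diff2-split k (zero ∷ b ∷ r , p , _) with to (diff2-∷∷ 0 b r) p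
... | () , _
diff2-split k (suc a ∷ b ∷ r , p , e) = diff2-split-top k a b r (to (diff2-∷∷ (suc a) b r) p) e
diff2-split k (zero ∷ [] , () , _)
diff2-split k (suc zero ∷ [] , _ , ())
diff2-split k (suc (suc a) ∷ [] , _ , e) = inj₁ (suc a ∷ [] , tt , suc-injective e)

diff2-merge : ∀ k → Parts diff2 (1 + k) ⊎ Parts⁺ diff2 k → Parts diff2 (2 + k)
diff2-merge k (inj₁ ([] , () , _))
diff2-merge k (inj₁ (a ∷ r , p , e)) =
  suc a ∷ r , diff2-suc-head a r p , trans (Γ-+-head 1 a r) (cong suc e)
diff2-merge k (inj₂ ([] , () , _))
diff2-merge k (inj₂ (b ∷ r , p , e)) =
  2 + b ∷ b ∷ r , from (diff2-∷∷ (2 + b) b r) (≤-refl , p) , trans (Γ-prepend 2 b r) (cong (2 +_) e)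

diff2-split-merge : ∀ k y → diff2-split k (diff2-merge k y) ≡ y
diff2-split-merge k (inj₁ ([] , () , _))
diff2-split-merge k (inj₁ (zero ∷ [] , () , _))
diff2-split-merge k (inj₁ (suc a ∷ [] , _ , _)) = cong inj₁ (parts-≡ refl)
diff2-split-merge k (inj₁ (a ∷ b ∷ r , p , e)) with a ≟ suc b
... | yes refl = ⊥-elim (1+n≰n (proj₁ (to (diff2-∷∷ (suc b) b r) p)))
... | no _     = cong inj₁ (parts-≡ refl)
diff2-split-merge k (inj₂ ([] , () , _))
diff2-split-merge k (inj₂ (b ∷ r , p , e)) with suc b ≟ suc b
... | yes refl = cong inj₂ (parts-≡ refl)
... | no ≢     = ⊥-elim (≢ refl)

diff2-merge-split : ∀ k x → diff2-merge k (diff2-split k x) ≡ x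
diff2-merge-split k ([] , () , _)
diff2-merge-split k (zero ∷ b ∷ r , p , _) with to (diff2-∷∷ 0 b r) p
... | () , _
diff2-merge-split k (suc a ∷ b ∷ r , p , e) with a ≟ suc b
... | yes refl = parts-≡ refl
... | no _     = parts-≡ refl
diff2-merge-split k (zero ∷ [] , () , _)
diff2-merge-split k (suc zero ∷ [] , _ , ())
diff2-merge-split k (suc (suc a) ∷ [] , _ , _) = parts-≡ refl

diff2-recurrence : ∀ k → Parts diff2 (2 + k) ↔ (Parts diff2 (1 + k) ⊎ Prev (Parts diff2) k)
diff2-recurrence k =
  ↔-trans (mk↔ₛ′ (diff2-split k) (diff2-merge k) (diff2-split-merge k) (diff2-merge-split k))
          (↔-refl ⊎-↔ Parts⁺↔Prev diff2 k)

%5-+ : ∀ d b s → b % 5 ≡ s % 5 → (d + b) % 5 ≡ (d + s) % 5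
%5-+ d b s eq = begin
  (d + b) % 5            ≡⟨ %-distribˡ-+ d b 5 ⟩
  (d % 5 + b % 5) % 5    ≡⟨ cong (λ x → (d % 5 + x) % 5) eq ⟩
  (d % 5 + s % 5) % 5    ≡⟨ %-distribˡ-+ d s 5 ⟨
  (d + s) % 5            ∎
  where open ≡-Reasoning

partOK-+ : ∀ d b s → b % 5 ≡ s % 5 → partOK (d + b) ≡ partOK (d + s)
partOK-+ d b s eq = cong (λ x → (x ≡ᵇ 1) ∨ (x ≡ᵇ 4)) (%5-+ d b s eq)

partOK-residue : ∀ a → T (partOK a) → a % 5 ≡ 1 ⊎ a % 5 ≡ 4
partOK-residue a p with to (T-∨ {a % 5 ≡ᵇ 1}) p
... | inj₁ t = inj₁ (≡ᵇ⇒≡ _ 1 t)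
... | inj₂ t = inj₂ (≡ᵇ⇒≡ _ 4 t)

4≢1 : 4 ≢ 1
4≢1 ()

gapOK-⇔ : ∀ d b → T (gapOK (d + b) b) ⇔ (d ≤ 5 × ((d + b) % 5 ≡ 1 → d ≤ 4))
gapOK-⇔ d b = mk⇔ unfold fold
  where
  cancel : ∀ {c} → d + b ≤ b + c → d ≤ c
  cancel {c} le = +-cancelʳ-≤ b d c (subst (d + b ≤_) (+-comm b c) le)
  widen : ∀ {c} → d ≤ c → d + b ≤ b + c
  widen {c} le = subst (d + b ≤_) (+-comm c b) (+-monoˡ-≤ b le)
  unfold : T (gapOK (d + b) b) → d ≤ 5 × ((d + b) % 5 ≡ 1 → d ≤ 4)
  unfold g with to (T-∧ {d + b ≤ᵇ b + 5}) g
  ... | ≤5 , tight =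
    cancel (≤ᵇ⇒≤ _ _ ≤5) , λ r≡1 → cancel (strict r≡1 (to (T-∨ {not ((d + b) % 5 ≡ᵇ 1)}) tight))
    where
    strict : (d + b) % 5 ≡ 1 → T (not ((d + b) % 5 ≡ᵇ 1)) ⊎ T (d + b ≤ᵇ b + 4) → d + b ≤ b + 4
    strict r≡1 (inj₁ t) = ⊥-elim (subst (λ x → T (not (x ≡ᵇ 1))) r≡1 t)
    strict _   (inj₂ t) = ≤ᵇ⇒≤ _ _ t
  fold : d ≤ 5 × ((d + b) % 5 ≡ 1 → d ≤ 4) → T (gapOK (d + b) b)
  fold (d≤5 , tight) =
    from (T-∧ {d + b ≤ᵇ b + 5}) (≤⇒≤ᵇ (widen d≤5) , from (T-∨ {not ((d + b) % 5 ≡ᵇ 1)}) strict)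
    where
    strict : T (not ((d + b) % 5 ≡ᵇ 1)) ⊎ T (d + b ≤ᵇ b + 4)
    strict with (d + b) % 5 ≡ᵇ 1 in eq
    ... | false = inj₁ tt
    ... | true  = inj₂ (≤⇒≤ᵇ (widen (tight (≡ᵇ⇒≡ _ 1 (subst T (sym eq) tt)))))

data Adjacent : ℕ → ℕ → Set where
  equal : ∀ a → Adjacent a a
  gap3  : ∀ {b} → b % 5 ≡ 1 → Adjacent (3 + b) b
  gap2  : ∀ {b} → b % 5 ≡ 4 → Adjacent (2 + b) b
  gap5  : ∀ {b} → b % 5 ≡ 4 → Adjacent (5 + b) b

adjacent-classify : ∀ d {b} → d ≤ 5 × ((d + b) % 5 ≡ 1 → d ≤ 4) → T (partOK (d + b)) →
                    b % 5 ≡ 1 ⊎ b % 5 ≡ 4 → Adjacent (d + b) b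
adjacent-classify 0 _ _ _ = equal _
adjacent-classify 1 {b} _ pa (inj₁ b1) = ⊥-elim (subst T (partOK-+ 1 b 1 b1) pa)
adjacent-classify 2 {b} _ pa (inj₁ b1) = ⊥-elim (subst T (partOK-+ 2 b 1 b1) pa)
adjacent-classify 3 _ _  (inj₁ b1) = gap3 b1
adjacent-classify 4 {b} _ pa (inj₁ b1) = ⊥-elim (subst T (partOK-+ 4 b 1 b1) pa)
adjacent-classify 5 {b} (_ , tight) _ (inj₁ b1) = ⊥-elim (1+n≰n (tight (%5-+ 5 b 1 b1)))
adjacent-classify 1 {b} _ pa (inj₂ b4) = ⊥-elim (subst T (partOK-+ 1 b 4 b4) pa)
adjacent-classify 2 _ _  (inj₂ b4) = gap2 b4
adjacent-classify 3 {b} _ pa (inj₂ b4) = ⊥-elim (subst T (partOK-+ 3 b 4 b4) pa)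
adjacent-classify 4 {b} _ pa (inj₂ b4) = ⊥-elim (subst T (partOK-+ 4 b 4 b4) pa)
adjacent-classify 5 _ _  (inj₂ b4) = gap5 b4
adjacent-classify (suc (suc (suc (suc (suc (suc _)))))) (s≤s (s≤s (s≤s (s≤s (s≤s ())))) , _) _ _

adjacent : ∀ {a b} → b ≤ a → T (partOK a) → T (gapOK a b) → b % 5 ≡ 1 ⊎ b % 5 ≡ 4 → Adjacent a b
adjacent {a} {b} b≤a pa ga rb =
  subst (λ x → Adjacent x b) a∸b+b≡a
    (adjacent-classify (a ∸ b) (to (gapOK-⇔ (a ∸ b) b) (subst (λ x → T (gapOK x b)) (sym a∸b+b≡a) ga))
                               (subst (λ x → T (partOK x)) (sym a∸b+b≡a) pa) rb)
  where
  a∸b+b≡a : a ∸ b + b ≡ a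
  a∸b+b≡a = m∸n+n≡m b≤a

adjacent-sound : ∀ {a b} → Adjacent a b → T (partOK b) → b ≤ a × T (partOK a) × T (gapOK a b)
adjacent-sound (equal a) pb = ≤-refl , pb , from (gapOK-⇔ 0 a) (z≤n , λ _ → z≤n)
adjacent-sound (gap3 {b} b1) _ =
  m≤n+m b 3 , subst T (sym (partOK-+ 3 b 1 b1)) tt , from (gapOK-⇔ 3 b) (≤ᵇ⇒≤ 3 5 tt , λ _ → ≤ᵇ⇒≤ 3 4 tt)
adjacent-sound (gap2 {b} b4) _ =
  m≤n+m b 2 , subst T (sym (partOK-+ 2 b 4 b4)) tt , from (gapOK-⇔ 2 b) (≤ᵇ⇒≤ 2 5 tt , λ _ → ≤ᵇ⇒≤ 2 4 tt)
adjacent-sound (gap5 {b} b4) _ =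
  m≤n+m b 5 , subst T (sym (partOK-+ 5 b 4 b4)) tt ,
  from (gapOK-⇔ 5 b) (≤-refl , λ r≡1 → ⊥-elim (4≢1 (trans (sym (%5-+ 5 b 4 b4)) r≡1)))

mod5-head : ∀ a r → IsPartitionWith mod5cond (a ∷ r) → T (partOK a)
mod5-head a []      p = proj₁ (to (T-∧ {partOK a}) (proj₂ (to (T-∧ {1 ≤ᵇ a}) p)))
mod5-head a (b ∷ r) p = proj₁ (to (T-∧ {partOK a}) (proj₂ (to (T-∧ {(b ≤ᵇ a) ∧ weaklyDecPos (b ∷ r)}) p)))

mod5-head-≢1 : ∀ c r → IsPartitionWith mod5cond (c ∷ r) → c % 5 ≢ 1 → c % 5 ≡ 4
mod5-head-≢1 c r p c≢1 with partOK-residue c (mod5-head c r p)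
... | inj₁ c1 = ⊥-elim (c≢1 c1)
... | inj₂ c4 = c4

mod5-singleton : ∀ a → IsPartitionWith mod5cond (a ∷ []) → a ≡ 1 ⊎ a ≡ 4
mod5-singleton a p = singleton a (to (T-∧ {partOK a}) (proj₂ (to (T-∧ {1 ≤ᵇ a}) p)))
  where
  singleton : ∀ n → T (partOK n) × T (gapOK n 0) → n ≡ 1 ⊎ n ≡ 4
  singleton 0 (() , _)
  singleton 1 _ = inj₁ refl
  singleton 2 (() , _)
  singleton 3 (() , _)
  singleton 4 _ = inj₂ refl
  singleton 5 (() , _)
  singleton (suc (suc (suc (suc (suc (suc _)))))) (_ , ())

mod5-∷∷ : ∀ a b r → IsPartitionWith mod5cond (a ∷ b ∷ r) ⇔ (Adjacent a b × IsPartitionWith mod5cond (b ∷ r))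
mod5-∷∷ a b r = mk⇔ unfold fold
  where
  unfold : IsPartitionWith mod5cond (a ∷ b ∷ r) → Adjacent a b × IsPartitionWith mod5cond (b ∷ r)
  unfold p with to (T-∧ {(b ≤ᵇ a) ∧ weaklyDecPos (b ∷ r)}) p
  ... | dec , m with to (T-∧ {b ≤ᵇ a}) dec | to (T-∧ {partOK a}) m
  ... | b≤a , dec′ | pa , m′ with to (T-∧ {gapOK a b}) m′
  ... | ga , m″ = adjacent (≤ᵇ⇒≤ b a b≤a) pa ga (partOK-residue b (mod5-head b r tail)) , tail
    where
    tail : IsPartitionWith mod5cond (b ∷ r)
    tail = from (T-∧ {weaklyDecPos (b ∷ r)}) (dec′ , m″)
  fold : Adjacent a b × IsPartitionWith mod5cond (b ∷ r) → IsPartitionWith mod5cond (a ∷ b ∷ r)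
  fold (adj , tail) with adjacent-sound adj (mod5-head b r tail) | to (T-∧ {weaklyDecPos (b ∷ r)}) tail
  ... | b≤a , pa , ga | dec′ , m″ =
    from (T-∧ {(b ≤ᵇ a) ∧ weaklyDecPos (b ∷ r)})
      (from (T-∧ {b ≤ᵇ a}) (≤⇒≤ᵇ b≤a , dec′) , from (T-∧ {partOK a}) (pa , from (T-∧ {gapOK a b}) (ga , m″)))

mod5-raise : ∀ c r → IsPartitionWith mod5cond (c ∷ r) → c % 5 ≡ 1 → IsPartitionWith mod5cond (3 + c ∷ r)
mod5-raise c [] p c1 with mod5-singleton c p
... | inj₁ refl = tt
... | inj₂ refl = ⊥-elim (4≢1 c1)
mod5-raise c (b ∷ r) p c1 with to (mod5-∷∷ c b r) p
... | equal _ , tail = from (mod5-∷∷ (3 + c) c r) (gap3 c1 , tail)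
... | gap3 b1 , _    = ⊥-elim (4≢1 (trans (sym (%5-+ 3 b 1 b1)) c1))
... | gap2 b4 , tail = from (mod5-∷∷ (5 + b) b r) (gap5 b4 , tail)
... | gap5 b4 , _    = ⊥-elim (4≢1 (trans (sym (%5-+ 5 b 4 b4)) c1))

mod5-split-top : ∀ k {a b} r → Adjacent a b × IsPartitionWith mod5cond (b ∷ r) → Γ (a ∷ b ∷ r) ≡ 2 + k →
                 Parts mod5cond (1 + k) ⊎ Parts⁺ mod5cond k
mod5-split-top k r (equal a , tail) e = inj₁ (a ∷ r , tail , suc-injective (trans (sym (Γ-prepend 0 a r)) e))
mod5-split-top k r (gap3 {b} _ , tail) e =
  inj₂ (b ∷ b ∷ r , from (mod5-∷∷ b b r) (equal b , tail) ,
        +-cancelˡ-≡ 2 _ _ (trans (sym (Γ-+-head 3 b (b ∷ r))) e))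
mod5-split-top k r (gap2 {b} _ , tail) e =
  inj₂ (b ∷ r , tail , +-cancelˡ-≡ 2 _ _ (trans (sym (Γ-prepend 2 b r)) e))
mod5-split-top k r (gap5 {b} b4 , tail) e =
  inj₂ (2 + b ∷ b ∷ r , from (mod5-∷∷ (2 + b) b r) (gap2 b4 , tail) ,
        +-cancelˡ-≡ 2 _ _ (trans (sym (Γ-+-head 3 (2 + b) (b ∷ r))) e))

mod5-split-single : ∀ k a → a ≡ 1 ⊎ a ≡ 4 → Γ (a ∷ []) ≡ 2 + k → Parts mod5cond (1 + k) ⊎ Parts⁺ mod5cond k
mod5-split-single k .1 (inj₁ refl) ()
mod5-split-single k .4 (inj₂ refl) e = inj₂ (1 ∷ [] , tt , suc-injective (suc-injective e))

mod5-split : ∀ k → Parts mod5cond (2 + k) → Parts mod5cond (1 + k) ⊎ Parts⁺ mod5cond k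
mod5-split k ([] , () , _)
mod5-split k (a ∷ [] , p , e)     = mod5-split-single k a (mod5-singleton a p) e
mod5-split k (a ∷ b ∷ r , p , e) = mod5-split-top k r (to (mod5-∷∷ a b r) p) e

mod5-merge : ∀ k → Parts mod5cond (1 + k) ⊎ Parts⁺ mod5cond k → Parts mod5cond (2 + k)
mod5-merge k (inj₁ ([] , () , _))
mod5-merge k (inj₁ (b ∷ r , p , e)) =
  b ∷ b ∷ r , from (mod5-∷∷ b b r) (equal b , p) , trans (Γ-prepend 0 b r) (cong suc e)
mod5-merge k (inj₂ ([] , () , _))
mod5-merge k (inj₂ (c ∷ r , p , e)) with c % 5 ≟ 1
... | yes c1 = 3 + c ∷ r , mod5-raise c r p c1 , trans (Γ-+-head 3 c r) (cong (2 +_) e)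
... | no c≢1 = 2 + c ∷ c ∷ r , from (mod5-∷∷ (2 + c) c r) (gap2 (mod5-head-≢1 c r p c≢1) , p) ,
               trans (Γ-prepend 2 c r) (cong (2 +_) e)

mod5-merge-split-top : ∀ k {a b} r top e → proj₁ (mod5-merge k (mod5-split-top k {a} {b} r top e)) ≡ a ∷ b ∷ r
mod5-merge-split-top k r (equal a , _) _ = refl
mod5-merge-split-top k r (gap3 {b} b1 , _) _ with b % 5 ≟ 1
... | yes _ = refl
... | no b≢1 = ⊥-elim (b≢1 b1)
mod5-merge-split-top k r (gap2 {b} b4 , _) _ with b % 5 ≟ 1
... | yes b1 = ⊥-elim (4≢1 (trans (sym b4) b1))
... | no _   = refl
mod5-merge-split-top k r (gap5 {b} b4 , _) _ with (2 + b) % 5 ≟ 1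
... | yes _    = refl
... | no 2+b≢1 = ⊥-elim (2+b≢1 (%5-+ 2 b 4 b4))

mod5-merge-split : ∀ k x → mod5-merge k (mod5-split k x) ≡ x
mod5-merge-split k ([] , () , _)
mod5-merge-split k (a ∷ [] , p , e) with mod5-singleton a p
mod5-merge-split k (.1 ∷ [] , p , ()) | inj₁ refl
mod5-merge-split k (.4 ∷ [] , p , e)  | inj₂ refl = parts-≡ refl
mod5-merge-split k (a ∷ b ∷ r , p , e) = parts-≡ (mod5-merge-split-top k r (to (mod5-∷∷ a b r) p) e)

-- The omitted shapes of the two largest parts would make a part exceed itself.
mod5-split-merge : ∀ k y → mod5-split k (mod5-merge k y) ≡ y
mod5-split-merge k (inj₁ ([] , () , _))
mod5-split-merge k (inj₁ (b ∷ r , p , e)) with to (mod5-∷∷ b b r) (from (mod5-∷∷ b b r) (equal b , p))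
... | equal _ , _ = cong inj₁ (parts-≡ refl)
mod5-split-merge k (inj₂ ([] , () , _))
mod5-split-merge k (inj₂ (c ∷ r , p , e)) with c % 5 ≟ 1
mod5-split-merge k (inj₂ (c ∷ [] , p , e)) | yes c1 with mod5-singleton (3 + c) (mod5-raise c [] p c1)
... | inj₂ refl = cong inj₂ (parts-≡ refl)
mod5-split-merge k (inj₂ (c ∷ b ∷ r , p , e)) | yes c1
  with to (mod5-∷∷ (3 + c) b r) (mod5-raise c (b ∷ r) p c1)
... | equal _ , _ = ⊥-elim (1+n≰n (≤-trans (s≤s (m≤n+m c 2)) (partition-≤ mod5cond c _ r p)))
... | gap3 _ , _  = cong inj₂ (parts-≡ refl)
... | gap2 _ , _  = ⊥-elim (1+n≰n (partition-≤ mod5cond c _ r p))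
... | gap5 _ , _  = cong inj₂ (parts-≡ refl)
mod5-split-merge k (inj₂ (c ∷ r , p , e)) | no c≢1
  with to (mod5-∷∷ (2 + c) c r) (from (mod5-∷∷ (2 + c) c r) (gap2 (mod5-head-≢1 c r p c≢1) , p))
... | gap2 _ , _ = cong inj₂ (parts-≡ refl)

mod5-recurrence : ∀ k → Parts mod5cond (2 + k) ↔ (Parts mod5cond (1 + k) ⊎ Prev (Parts mod5cond) k)
mod5-recurrence k =
  ↔-trans (mk↔ₛ′ (mod5-split k) (mod5-merge k) (mod5-split-merge k) (mod5-merge-split k))
          (↔-refl ⊎-↔ Parts⁺↔Prev mod5cond k)

corollary2p18 : (m : ℕ) → Diff2Parts (suc m) ↔ Mod5Parts (suc m)
corollary2p18 m = ↔-by-recurrence no-parts one-part diff2-recurrence mod5-recurrence (suc m)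
  where
  no-parts : Parts diff2 0 ↔ Parts mod5cond 0
  no-parts = ↔-trans (Parts-0 diff2) (↔-sym (Parts-0 mod5cond))
  one-part : Parts diff2 1 ↔ Parts mod5cond 1
  one-part = ↔-trans (Parts-1 diff2 tt) (↔-sym (Parts-1 mod5cond tt))
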